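{- For every natural number $n$, there exists a set $A$ of positive integers with $|A|=n$ such that the graph $G_\phi(A)$ has size $n$ (i.e. exactly $n$ edges).
   Context: $\phi$ denotes Euler's totient function, $\phi^0(n)=n$ and $\phi^i(n)=\phi(\phi^{i-1}(n))$. For a set $A$ of positive integers, $A_\phi=\{\phi^k(n): n\in A,\ k\ge 0\}$, and $G_\phi(A)$ is the simple graph with vertex set $A_\phi$ in which distinct vertices $r,s$ are adjacent iff $\phi(r)=s$ or $\phi(s)=r$. The size of a graph is its number of edges. -}

module Defs where

open import Data.Nat using (ℕ; zero; suc; _<_; _≟_)
open import Data.Nat.GCD using (gcd)
open import Data.List using (List; filter; upTo; length; map)
open import Data.List.Membership.Propositional using (_∈_)
open import Data.List.Relation.Unary.Unique.Propositional using (Unique)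
open import Data.Product using (_×_; ∃; ∃-syntax; _,_)
open import Data.Sum using (_⊎_)
open import Relation.Binary.PropositionalEquality using (_≡_; _≢_)
open import Function.Bundles using (_⇔_)

-- Euler's totient: φ n = #{ k : 1 ≤ k ≤ n , gcd k n = 1 }.
-- (φ 0 = 0, irrelevant since only positive integers occur.)
φ : ℕ → ℕ
φ n = length (filter (λ k → gcd (suc k) n ≟ 1) (upTo n))

φ^ : ℕ → ℕ → ℕ
φ^ zero    n = n
φ^ (suc i) n = φ (φ^ i n)

_∈Aφ_ : ℕ → List ℕ → Set
m ∈Aφ A = ∃[ a ] ∃[ k ] (a ∈ A × φ^ k a ≡ m)

Adj : List ℕ → ℕ → ℕ → Set
Adj A r s = r ∈Aφ A × s ∈Aφ A × r ≢ s × (φ r ≡ s ⊎ φ s ≡ r)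

-- G_φ(A) has exactly m edges: there is a duplicate-free list of pairs (r , s)
-- with r < s (one representative per unordered edge {r,s}) which contains
-- exactly the edges of G_φ(A), and has length m.
HasSize : List ℕ → ℕ → Set
HasSize A m = ∃[ E ] (Unique E
                × (∀ r s → ((r , s) ∈ E) ⇔ (r < s × Adj A r s))
                × length E ≡ m)

-- Take A = {2, 3, …, n + 1}. Since φ m < m for m ≥ 2 and φ m ≥ 1 for m ≥ 1,
-- A_φ = A ∪ {1}, and G_φ(A) is a tree rooted at 1 in which each s ∈ A is joined
-- exactly to φ s < s; indexing each edge by its larger end gives |A| = n edges.
module Submission where

open import Defs
open import Data.Nat using (ℕ; zero; suc; _+_; _≤_; _<_; _>_; z≤n; z<s; s≤s; _≟_)
open import Data.Nat.Properties
  using (≤-refl; ≤-trans; <-trans; ≤-<-trans; <⇒≢; <⇒≱)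
open import Data.Nat.GCD using (gcd; gcd-zeroˡ; gcd-greatest)
open import Data.Nat.Divisibility using (_∣_; ∣-refl; ∣1⇒≡1)
open import Data.List using (List; length; filter; upTo; applyUpTo; map)
open import Data.List.Properties
  using (length-filter; filter-notAll; filter-some; length-upTo; length-map; length-applyUpTo)
open import Data.List.Relation.Unary.All as All using (All)
open import Data.List.Relation.Unary.Any using (here)
open import Data.List.Relation.Unary.Unique.Propositional using (Unique)
open import Data.List.Relation.Unary.Unique.Propositional.Properties using (map⁺; applyUpTo⁺₁)
open import Data.List.Membership.Propositional using (_∈_; lose)
open import Data.List.Membership.Propositional.Properties
  using (∈-map⁺; ∈-map⁻; ∈-applyUpTo⁺; ∈-applyUpTo⁻; ∈-upTo⁺)
open import Data.Product using (_×_; ∃-syntax; _,_; proj₁; proj₂)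
open import Data.Sum using (inj₁; inj₂)
open import Data.Empty using (⊥-elim)
open import Relation.Nullary using (Dec; ¬_)
open import Function using (_∘_)
open import Function.Bundles using (mk⇔)
open import Relation.Binary.PropositionalEquality using (_≡_; refl; subst; cong)

-- Exactly the filter predicate in the definition of φ n, so filter lemmas apply to φ by computation.
coprime? : (n k : ℕ) → Dec (gcd (suc k) n ≡ 1)
coprime? n k = gcd (suc k) n ≟ 1

φ-≤ : ∀ n → φ n ≤ n
φ-≤ n = subst (φ n ≤_) (length-upTo n) (length-filter (coprime? n) (upTo n))

φ-pos : ∀ {n} → 0 < n → 0 < φ n
φ-pos {suc n} _ = filter-some (coprime? (suc n)) {upTo (suc n)} (here (gcd-zeroˡ (suc n)))

gcd-self≢1 : ∀ {n} → 1 < n → ¬ gcd n n ≡ 1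
gcd-self≢1 {suc zero} (s≤s ())
gcd-self≢1 {suc (suc n)} _ eq with ∣1⇒≡1 (subst (suc (suc n) ∣_) eq (gcd-greatest ∣-refl ∣-refl))
... | ()

φ-< : ∀ {n} → 1 < n → φ n < n
φ-< {suc n} 1<n = subst (φ (suc n) <_) (length-upTo (suc n))
  (filter-notAll (coprime? (suc n)) (upTo (suc n))
    (lose (∈-upTo⁺ ≤-refl) (gcd-self≢1 1<n)))

φ^-≤ : ∀ k n → φ^ k n ≤ n
φ^-≤ zero    n = ≤-refl
φ^-≤ (suc k) n = ≤-trans (φ-≤ (φ^ k n)) (φ^-≤ k n)

φ^-pos : ∀ k {n} → 0 < n → 0 < φ^ k n
φ^-pos zero    0<n = 0<n
φ^-pos (suc k) 0<n = φ-pos (φ^-pos k 0<n)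

module _ {A : List ℕ} where

  ∈⇒∈Aφ : ∀ {a} → a ∈ A → a ∈Aφ A
  ∈⇒∈Aφ {a} a∈A = a , 0 , a∈A , refl

  φ-∈Aφ : ∀ {a} → a ∈ A → φ a ∈Aφ A
  φ-∈Aφ {a} a∈A = a , 1 , a∈A , refl

  ∈Aφ-pos : All (0 <_) A → ∀ {m} → m ∈Aφ A → 0 < m
  ∈Aφ-pos A⁺ (a , k , a∈A , refl) = φ^-pos k (All.lookup A⁺ a∈A)

  ∈Aφ-≤ : ∀ {N} → All (_≤ N) A → ∀ {m} → m ∈Aφ A → m ≤ N
  ∈Aφ-≤ A≤N (a , k , a∈A , refl) = ≤-trans (φ^-≤ k a) (All.lookup A≤N a∈A)

parentEdge : ℕ → ℕ × ℕ
parentEdge s = φ s , s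

parentEdges : List ℕ → List (ℕ × ℕ)
parentEdges = map parentEdge

module _ {A : List ℕ} (A>1 : All (1 <_) A) (closed : ∀ {m} → m ∈Aφ A → 1 < m → m ∈ A) where

  ∈-parentEdges⇒Adj : ∀ {r s} → (r , s) ∈ parentEdges A → r < s × Adj A r s
  ∈-parentEdges⇒Adj p with ∈-map⁻ parentEdge p
  ... | s , s∈A , refl = r<s , φ-∈Aφ s∈A , ∈⇒∈Aφ s∈A , <⇒≢ r<s , inj₂ refl
    where
    r<s : φ s < s
    r<s = φ-< (All.lookup A>1 s∈A)

  Adj⇒∈-parentEdges : ∀ {r s} → r < s → Adj A r s → (r , s) ∈ parentEdges A
  Adj⇒∈-parentEdges r<s (_ , _ , _ , inj₁ φr≡s) = ⊥-elim (<⇒≱ r<s (subst (_≤ _) φr≡s (φ-≤ _)))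
  Adj⇒∈-parentEdges {s = s} r<s (r∈Aφ , s∈Aφ , _ , inj₂ refl) = ∈-map⁺ parentEdge (closed s∈Aφ 1<s)
    where
    1<s : 1 < s
    1<s = ≤-<-trans (∈Aφ-pos (All.map (<-trans z<s) A>1) r∈Aφ) r<s

  HasSize-length : Unique A → HasSize A (length A)
  HasSize-length A! =
    parentEdges A ,
    map⁺ (cong proj₂) A! ,
    (λ r s → mk⇔ ∈-parentEdges⇒Adj (λ (r<s , adj) → Adj⇒∈-parentEdges r<s adj)) ,
    length-map _ A

twoUpTo : ℕ → List ℕ
twoUpTo = applyUpTo (2 +_)

module _ (n : ℕ) where

  ∈-twoUpTo⁻ : ∀ {m} → m ∈ twoUpTo n → 1 < m × m ≤ 1 + n
  ∈-twoUpTo⁻ p with ∈-applyUpTo⁻ (2 +_) p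
  ... | i , i<n , refl = s≤s (s≤s z≤n) , s≤s i<n

  ∈-twoUpTo⁺ : ∀ {m} → 1 < m → m ≤ 1 + n → m ∈ twoUpTo n
  ∈-twoUpTo⁺ {suc zero}    (s≤s ()) _
  ∈-twoUpTo⁺ {suc (suc i)} _        (s≤s i<n) = ∈-applyUpTo⁺ (2 +_) i<n

  twoUpTo-unique : Unique (twoUpTo n)
  twoUpTo-unique = applyUpTo⁺₁ (2 +_) n (λ i<j _ → <⇒≢ (s≤s (s≤s i<j)))

  twoUpTo>1 : All (1 <_) (twoUpTo n)
  twoUpTo>1 = All.tabulate (proj₁ ∘ ∈-twoUpTo⁻)

  twoUpTo-φ-closed : ∀ {m} → m ∈Aφ twoUpTo n → 1 < m → m ∈ twoUpTo n
  twoUpTo-φ-closed m∈Aφ 1<m = ∈-twoUpTo⁺ 1<m (∈Aφ-≤ (All.tabulate (proj₂ ∘ ∈-twoUpTo⁻)) m∈Aφ)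

theorem2p6 : (n : ℕ) → ∃[ A ] (Unique A × All (_> 0) A × length A ≡ n × HasSize A n)
theorem2p6 n =
  twoUpTo n ,
  twoUpTo-unique n ,
  All.map (<-trans z<s) (twoUpTo>1 n) ,
  length-twoUpTo ,
  subst (HasSize (twoUpTo n)) length-twoUpTo
    (HasSize-length (twoUpTo>1 n) (twoUpTo-φ-closed n) (twoUpTo-unique n))
  where
  length-twoUpTo : length (twoUpTo n) ≡ n
  length-twoUpTo = length-applyUpTo (2 +_) n
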